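{- Let $n\ge1$. The matrix $T$ satisfies $T\cdot T=\mathrm{id}$ (so $T$ is bijective), and for every $\sigma\in\mathrm{Sym}(n+1)$ one has $Q(\sigma)=T\cdot P(\sigma)\cdot T$ and $Q(\sigma)\in\mathrm{GL}((\mathbb{Z}/2\mathbb{Z})^{n+1})$.
   Context: $\mathrm{Sym}(n+1)$ is the group of bijections of $\{1,\dots,n+1\}$ with product $\sigma\cdot\rho:=\rho\circ\sigma$; $(i\ j)$ is a transposition. $\delta_{i,j}\in\mathbb{Z}/2\mathbb{Z}$ is the Kronecker delta; all arithmetic is in $\mathbb{Z}/2\mathbb{Z}$. Define matrices indexed by $i,j\in\{1,\dots,n+1\}$: $P(\sigma)_{i,j}=\delta_{\sigma(i),j}$; $T_{i,j}=\delta_{i,j}+\delta_{j,n+1}(1+\delta_{i,n+1})$; and $Q(\sigma)_{i,j}=\delta_{(n+1\ \sigma(n+1))(\sigma(i)),\,j}+\delta_{\sigma(n+1),j}(1+\delta_{n+1,\sigma(i)})(1+\delta_{\sigma(n+1),n+1})$, where $(n+1\ \sigma(n+1))$ is the identity when $\sigma(n+1)=n+1$. -}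

module Defs where

open import Data.Nat using (ℕ; suc)
open import Data.Bool using (Bool; true; false; _xor_; _∧_; not)
open import Data.Fin using (Fin; fromℕ)
open import Data.Fin.Properties using (_≟_)
open import Data.Fin.Permutation using (Permutation′; _⟨$⟩ʳ_; transpose)
open import Relation.Nullary using (does)
open import Relation.Binary.PropositionalEquality using (_≡_)
open import Data.Product using (Σ; _×_)

Z2 : Set
Z2 = Bool

0₂ 1₂ : Z2
0₂ = false
1₂ = true

_+₂_ _*₂_ : Z2 → Z2 → Z2
_+₂_ = _xor_
_*₂_ = _∧_
infixl 6 _+₂_
infixl 7 _*₂_

δ : ∀ {m} → Fin m → Fin m → Z2
δ i j = does (i ≟ j)

Mat : ℕ → Set
Mat m = Fin m → Fin m → Z2

Σ₂ : ∀ m → (Fin m → Z2) → Z2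
Σ₂ ℕ.zero f = 0₂
Σ₂ (suc m) f = f Fin.zero +₂ Σ₂ m (λ k → f (Fin.suc k))

_·_ : ∀ {m} → Mat m → Mat m → Mat m
_·_ {m} A B i j = Σ₂ m (λ k → A i k *₂ B k j)
infixl 7 _·_

idM : ∀ {m} → Mat m
idM i j = δ i j

_≈M_ : ∀ {m} → Mat m → Mat m → Set
A ≈M B = ∀ i j → A i j ≡ B i j

IsInvertible : ∀ {m} → Mat m → Set
IsInvertible {m} A = Σ (Mat m) (λ B → (A · B) ≈M idM × (B · A) ≈M idM)

-- Sym(n+1) as permutations of Fin (suc n); index fromℕ n plays the role of n+1,
-- index k (toℕ k = i-1) plays the role of i.
Sym : ℕ → Set
Sym n = Permutation′ (suc n)

last : ∀ n → Fin (suc n)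
last n = fromℕ n

P : ∀ {n} → Sym n → Mat (suc n)
P σ i j = δ (σ ⟨$⟩ʳ i) j

T : ∀ n → Mat (suc n)
T n i j = δ i j +₂ δ j (last n) *₂ (1₂ +₂ δ i (last n))

-- (n+1 σ(n+1)) is transpose (last n) (σ(last n)); transpose i i is the identity
Q : ∀ {n} → Sym n → Mat (suc n)
Q {n} σ i j =
  δ (transpose (last n) (σ ⟨$⟩ʳ last n) ⟨$⟩ʳ (σ ⟨$⟩ʳ i)) j
  +₂ δ (σ ⟨$⟩ʳ last n) j *₂ (1₂ +₂ δ (last n) (σ ⟨$⟩ʳ i))
                          *₂ (1₂ +₂ δ (σ ⟨$⟩ʳ last n) (last n))

{-# OPTIONS --safe #-}
-- Left multiplication by T adds the last row to each of the other rows; doing it twice adds it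
-- twice, i.e. not at all, so T is an involution. Row i of T P(σ) T is T_{σ(i)} + [i ≠ n+1] T_{σ(n+1)},
-- and comparing this with Q(σ) is a finite case analysis on which of σ(i), σ(n+1), n+1 coincide.
-- Hence Q(σ) is the conjugate of the invertible P(σ) by the involution T, with inverse T P(σ⁻¹) T.
module Submission where

open import Defs
open import Algebra.Bundles using (Monoid; CommutativeRing)
import Algebra.Properties.Monoid as MonoidProperties
open import Data.Bool using (true; false)
open import Data.Bool.Properties
  using (xor-∧-commutativeRing; xor-assoc; xor-same; xor-identityʳ; ∧-comm; ∧-assoc; ∧-zeroʳ; ∧-distribʳ-xor)
open import Data.Nat using (ℕ; suc; _≤_)
open import Data.Fin using (Fin; zero; suc)
open import Data.Fin.Properties using (_≟_)
open import Data.Fin.Permutation using (Permutation′; _⟨$⟩ʳ_; _⟨$⟩ˡ_; flip; transpose; inverseˡ; inverseʳ)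
open import Data.Product using (_×_; _,_)
open import Function.Bundles using (mk⇔)
open import Level using (0ℓ)
open import Relation.Binary.PropositionalEquality using (_≡_; refl; sym; trans; cong; cong₂; module ≡-Reasoning)
open import Relation.Nullary.Decidable using (dec-true; dec-false; does-⇔)
open import Relation.Nullary using (¬_; yes; no)

open import Algebra.Properties.Semiring.Sum (CommutativeRing.semiring xor-∧-commutativeRing)
  using (sum; sum-syntax; sum-cong-≗; sum-replicate-zero; ∑-comm; ∑-distrib-+; *-distribˡ-sum; *-distribʳ-sum)

module _ {c ℓ} (M : Monoid c ℓ) where
  open Monoid M
  open MonoidProperties M using (cancelᶜ; uv∙wx≈u[vw∙x]; elimˡ)
  open import Relation.Binary.Reasoning.Setoid setoid

  conjugate-inverse : ∀ {t x y} → t ∙ t ≈ ε → x ∙ y ≈ ε → t ∙ x ∙ t ∙ (t ∙ y ∙ t) ≈ ε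
  conjugate-inverse {t} {x} {y} tt≈ε xy≈ε = begin
    t ∙ x ∙ t ∙ (t ∙ y ∙ t)    ≈⟨ ∙-congˡ (assoc t y t) ⟩
    t ∙ x ∙ t ∙ (t ∙ (y ∙ t))  ≈⟨ cancelᶜ tt≈ε (t ∙ x) (y ∙ t) ⟩
    t ∙ x ∙ (y ∙ t)            ≈⟨ uv∙wx≈u[vw∙x] t x y t ⟩
    t ∙ (x ∙ y ∙ t)            ≈⟨ ∙-congˡ (elimˡ xy≈ε t) ⟩
    t ∙ t                      ≈⟨ tt≈ε ⟩
    ε                          ∎

open ≡-Reasoning

δ-refl : ∀ {m} (i : Fin m) → δ i i ≡ 1₂
δ-refl i = dec-true (i ≟ i) refl

δ-≢ : ∀ {m} {i j : Fin m} → ¬ i ≡ j → δ i j ≡ 0₂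
δ-≢ {i = i} {j} = dec-false (i ≟ j)

δ-sym : ∀ {m} (i j : Fin m) → δ i j ≡ δ j i
δ-sym i j = does-⇔ (mk⇔ sym sym) (i ≟ j) (j ≟ i)

module _ {m : ℕ} (σ : Permutation′ m) where

  δ-⟨$⟩ʳ : ∀ i j → δ (σ ⟨$⟩ʳ i) j ≡ δ i (σ ⟨$⟩ˡ j)
  δ-⟨$⟩ʳ i j = does-⇔
    (mk⇔ (λ σi≡j → trans (sym (inverseˡ σ)) (cong (σ ⟨$⟩ˡ_) σi≡j))
         (λ i≡σ⁻¹j → trans (cong (σ ⟨$⟩ʳ_) i≡σ⁻¹j) (inverseʳ σ)))
    ((σ ⟨$⟩ʳ i) ≟ j) (i ≟ (σ ⟨$⟩ˡ j))

  δ-injective : ∀ i j → δ (σ ⟨$⟩ʳ i) (σ ⟨$⟩ʳ j) ≡ δ i j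
  δ-injective i j = trans (δ-⟨$⟩ʳ i (σ ⟨$⟩ʳ j)) (cong (δ i) (inverseˡ σ))

Σ₂≡sum : ∀ m (f : Fin m → Z2) → Σ₂ m f ≡ sum f
Σ₂≡sum ℕ.zero    f = refl
Σ₂≡sum (suc m) f = cong (f zero +₂_) (Σ₂≡sum m (λ k → f (suc k)))

sum-δˡ : ∀ {m} (i : Fin m) (f : Fin m → Z2) → ∑[ k < m ] (δ i k *₂ f k) ≡ f i
sum-δˡ {suc m} zero    f = trans (cong (f zero +₂_) (sum-replicate-zero m)) (xor-identityʳ (f zero))
sum-δˡ {suc m} (suc i) f = sum-δˡ i (λ k → f (suc k))

·-entry : ∀ {m} (A B : Mat m) i j → (A · B) i j ≡ ∑[ k < m ] (A i k *₂ B k j)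
·-entry {m} A B i j = Σ₂≡sum m (λ k → A i k *₂ B k j)

·-cong : ∀ {m} {A A′ B B′ : Mat m} → A ≈M A′ → B ≈M B′ → (A · B) ≈M (A′ · B′)
·-cong {m} {A} {A′} {B} {B′} A≈A′ B≈B′ i j = begin
  (A · B) i j                    ≡⟨ ·-entry A B i j ⟩
  ∑[ k < m ] (A i k *₂ B k j)    ≡⟨ sum-cong-≗ (λ k → cong₂ _*₂_ (A≈A′ i k) (B≈B′ k j)) ⟩
  ∑[ k < m ] (A′ i k *₂ B′ k j)  ≡⟨ ·-entry A′ B′ i j ⟨
  (A′ · B′) i j                  ∎

·-assoc : ∀ {m} (A B C : Mat m) → (A · B · C) ≈M (A · (B · C))
·-assoc {m} A B C i j = begin
  (A · B · C) i j                                      ≡⟨ ·-entry (A · B) C i j ⟩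
  ∑[ k < m ] ((A · B) i k *₂ C k j)                    ≡⟨ sum-cong-≗ (λ k → cong (_*₂ C k j) (·-entry A B i k)) ⟩
  ∑[ k < m ] (∑[ l < m ] (A i l *₂ B l k) *₂ C k j)    ≡⟨ sum-cong-≗ (λ k → *-distribʳ-sum (C k j) (λ l → A i l *₂ B l k)) ⟩
  ∑[ k < m ] (∑[ l < m ] (A i l *₂ B l k *₂ C k j))    ≡⟨ ∑-comm (λ k l → A i l *₂ B l k *₂ C k j) ⟩
  ∑[ l < m ] (∑[ k < m ] (A i l *₂ B l k *₂ C k j))    ≡⟨ sum-cong-≗ (λ l → sum-cong-≗ (λ k → ∧-assoc (A i l) (B l k) (C k j))) ⟩
  ∑[ l < m ] (∑[ k < m ] (A i l *₂ (B l k *₂ C k j)))  ≡⟨ sum-cong-≗ (λ l → *-distribˡ-sum (A i l) (λ k → B l k *₂ C k j)) ⟨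
  ∑[ l < m ] (A i l *₂ ∑[ k < m ] (B l k *₂ C k j))    ≡⟨ sum-cong-≗ (λ l → cong (A i l *₂_) (·-entry B C l j)) ⟨
  ∑[ l < m ] (A i l *₂ (B · C) l j)                    ≡⟨ ·-entry A (B · C) i j ⟨
  (A · (B · C)) i j                                    ∎

·-identityˡ : ∀ {m} (A : Mat m) → (idM · A) ≈M A
·-identityˡ A i j = trans (·-entry idM A i j) (sum-δˡ i (λ k → A k j))

·-identityʳ : ∀ {m} (A : Mat m) → (A · idM) ≈M A
·-identityʳ {m} A i j = begin
  (A · idM) i j                ≡⟨ ·-entry A idM i j ⟩
  ∑[ k < m ] (A i k *₂ δ k j)  ≡⟨ sum-cong-≗ (λ k → trans (∧-comm (A i k) (δ k j)) (cong (_*₂ A i k) (δ-sym k j))) ⟩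
  ∑[ k < m ] (δ j k *₂ A i k)  ≡⟨ sum-δˡ j (A i) ⟩
  A i j                        ∎

Mat-monoid : ℕ → Monoid 0ℓ 0ℓ
Mat-monoid m = record
  { Carrier  = Mat m
  ; _≈_      = _≈M_
  ; _∙_      = _·_
  ; ε        = idM
  ; isMonoid = record
    { isSemigroup = record
      { isMagma = record
        { isEquivalence = record
          { refl  = λ i j → refl
          ; sym   = λ A≈B i j → sym (A≈B i j)
          ; trans = λ A≈B B≈C i j → trans (A≈B i j) (B≈C i j)
          }
        ; ∙-cong = ·-cong
        }
      ; assoc = ·-assoc
      }
    ; identity = ·-identityˡ , ·-identityʳ
    }
  }

IsInvertible-resp-≈M : ∀ {m} {A B : Mat m} → A ≈M B → IsInvertible B → IsInvertible A
IsInvertible-resp-≈M {m} A≈B (B⁻¹ , BB⁻¹≈id , B⁻¹B≈id) =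
  B⁻¹ , M.trans (M.∙-congʳ A≈B) BB⁻¹≈id , M.trans (M.∙-congˡ A≈B) B⁻¹B≈id
  where module M = Monoid (Mat-monoid m)

IsInvertible-conjugate : ∀ {m} {S X : Mat m} → (S · S) ≈M idM → IsInvertible X → IsInvertible (S · X · S)
IsInvertible-conjugate {m} {S} SS≈id (X⁻¹ , XX⁻¹≈id , X⁻¹X≈id) =
  S · X⁻¹ · S , conjugate-inverse (Mat-monoid m) SS≈id XX⁻¹≈id
              , conjugate-inverse (Mat-monoid m) SS≈id X⁻¹X≈id

P·-entry : ∀ {n} (σ : Sym n) (A : Mat (suc n)) i j → (P σ · A) i j ≡ A (σ ⟨$⟩ʳ i) j
P·-entry σ A i j = trans (·-entry (P σ) A i j) (sum-δˡ (σ ⟨$⟩ʳ i) (λ k → A k j))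

P-invertible : ∀ {n} (σ : Sym n) → IsInvertible (P σ)
P-invertible σ =
  P (flip σ) , (λ i j → trans (P·-entry σ (P (flip σ)) i j) (cong (λ k → δ k j) (inverseˡ σ)))
             , (λ i j → trans (P·-entry (flip σ) (P σ) i j) (cong (λ k → δ k j) (inverseʳ σ)))

T·-entry : ∀ {n} (A : Mat (suc n)) i j → (T n · A) i j ≡ A i j +₂ (1₂ +₂ δ i (last n)) *₂ A (last n) j
T·-entry {n} A i j = begin
  (T n · A) i j                                                ≡⟨ ·-entry (T n) A i j ⟩
  ∑[ k < suc n ] (T n i k *₂ A k j)                            ≡⟨ sum-cong-≗ T-distrib ⟩
  ∑[ k < suc n ] (δ i k *₂ A k j +₂ c *₂ (δ L k *₂ A k j))     ≡⟨ ∑-distrib-+ (λ k → δ i k *₂ A k j) (λ k → c *₂ (δ L k *₂ A k j)) ⟩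
  ∑[ k < suc n ] (δ i k *₂ A k j)
    +₂ ∑[ k < suc n ] (c *₂ (δ L k *₂ A k j))                  ≡⟨ cong (∑[ k < suc n ] (δ i k *₂ A k j) +₂_) (*-distribˡ-sum c (λ k → δ L k *₂ A k j)) ⟨
  ∑[ k < suc n ] (δ i k *₂ A k j)
    +₂ c *₂ ∑[ k < suc n ] (δ L k *₂ A k j)                    ≡⟨ cong₂ (λ x y → x +₂ c *₂ y) (sum-δˡ i (λ k → A k j)) (sum-δˡ L (λ k → A k j)) ⟩
  A i j +₂ c *₂ A L j                                          ∎
  where
  L : Fin (suc n)
  L = last n
  c : Z2
  c = 1₂ +₂ δ i L
  T-distrib : ∀ k → T n i k *₂ A k j ≡ δ i k *₂ A k j +₂ c *₂ (δ L k *₂ A k j)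
  T-distrib k = begin
    (δ i k +₂ δ k L *₂ c) *₂ A k j           ≡⟨ ∧-distribʳ-xor (A k j) (δ i k) (δ k L *₂ c) ⟩
    δ i k *₂ A k j +₂ δ k L *₂ c *₂ A k j    ≡⟨ cong (λ d → δ i k *₂ A k j +₂ d *₂ A k j) (trans (∧-comm (δ k L) c) (cong (c *₂_) (δ-sym k L))) ⟩
    δ i k *₂ A k j +₂ c *₂ δ L k *₂ A k j    ≡⟨ cong (δ i k *₂ A k j +₂_) (∧-assoc c (δ L k) (A k j)) ⟩
    δ i k *₂ A k j +₂ c *₂ (δ L k *₂ A k j)  ∎

T-last-row : ∀ n j → T n (last n) j ≡ δ (last n) j
T-last-row n j rewrite δ-refl (last n) | ∧-zeroʳ (δ j (last n)) = xor-identityʳ (δ (last n) j)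

T-involutive : ∀ n → (T n · T n) ≈M idM
T-involutive n i j = begin
  (T n · T n) i j                       ≡⟨ T·-entry (T n) i j ⟩
  T n i j +₂ c *₂ T n L j               ≡⟨ cong (λ x → T n i j +₂ c *₂ x) (trans (T-last-row n j) (δ-sym L j)) ⟩
  δ i j +₂ δ j L *₂ c +₂ c *₂ δ j L     ≡⟨ xor-assoc (δ i j) (δ j L *₂ c) (c *₂ δ j L) ⟩
  δ i j +₂ (δ j L *₂ c +₂ c *₂ δ j L)   ≡⟨ cong (λ x → δ i j +₂ (x +₂ c *₂ δ j L)) (∧-comm (δ j L) c) ⟩
  δ i j +₂ (c *₂ δ j L +₂ c *₂ δ j L)   ≡⟨ cong (δ i j +₂_) (xor-same (c *₂ δ j L)) ⟩
  δ i j +₂ 0₂                           ≡⟨ xor-identityʳ (δ i j) ⟩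
  δ i j                                 ∎
  where
  L : Fin (suc n)
  L = last n
  c : Z2
  c = 1₂ +₂ δ i L

-- Q σ i j is the left-hand side at a = σ(i), b = σ(n+1). Splitting on a ≟ n+1, b ≟ n+1 and
-- a ≟ b also evaluates the transposition, which is computed from the same decisions; what
-- remains is a Boolean identity in δ a j, δ b j and δ (n+1) j.
transpose-last-entry : ∀ {n} (a b j : Fin (suc n)) →
  δ (transpose (last n) b ⟨$⟩ʳ a) j +₂ δ b j *₂ (1₂ +₂ δ (last n) a) *₂ (1₂ +₂ δ b (last n))
  ≡ T n a j +₂ (1₂ +₂ δ a b) *₂ T n b j
transpose-last-entry {n} a b j with a ≟ last n | b ≟ last n
transpose-last-entry {n} _ _ j | yes refl | yes refl
  rewrite δ-refl (last n) | δ-sym j (last n) with δ (last n) j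
... | false = refl
... | true  = refl
transpose-last-entry {n} _ b j | yes refl | no b≢L
  rewrite δ-refl (last n) | δ-sym (last n) b | δ-≢ b≢L | δ-sym j (last n) with δ b j | δ (last n) j
... | false | false = refl
... | false | true  = refl
... | true  | false = refl
... | true  | true  = refl
transpose-last-entry {n} a _ j | no a≢L | yes refl
  rewrite δ-sym (last n) a | δ-≢ a≢L | δ-sym j (last n) with δ a j | δ (last n) j
... | false | false = refl
... | false | true  = refl
... | true  | false = refl
... | true  | true  = refl
transpose-last-entry {n} a b j | no a≢L | no b≢L with a ≟ b
... | yes refl
  rewrite δ-sym (last n) a | δ-≢ a≢L | δ-sym j (last n) with δ a j | δ (last n) j
...   | false | false = refl
...   | false | true  = refl
...   | true  | false = refl
...   | true  | true  = refl
transpose-last-entry {n} a b j | no a≢L | no b≢L | no a≢b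
  rewrite δ-sym (last n) a | δ-≢ a≢L | δ-sym j (last n) with δ a j | δ b j | δ (last n) j
... | false | false | false = refl
... | false | false | true  = refl
... | false | true  | false = refl
... | false | true  | true  = refl
... | true  | false | false = refl
... | true  | false | true  = refl
... | true  | true  | false = refl
... | true  | true  | true  = refl

module _ {n : ℕ} (σ : Sym n) where
  private
    L : Fin (suc n)
    L = last n

    c : Fin (suc n) → Z2
    c i = 1₂ +₂ δ i L

  Q-entry : ∀ i j → Q σ i j ≡ T n (σ ⟨$⟩ʳ i) j +₂ c i *₂ T n (σ ⟨$⟩ʳ L) j
  Q-entry i j = trans (transpose-last-entry (σ ⟨$⟩ʳ i) (σ ⟨$⟩ʳ L) j)
                      (cong (λ d → T n (σ ⟨$⟩ʳ i) j +₂ (1₂ +₂ d) *₂ T n (σ ⟨$⟩ʳ L) j) (δ-injective σ i L))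

  TPT-entry : ∀ i j → (T n · P σ · T n) i j ≡ T n (σ ⟨$⟩ʳ i) j +₂ c i *₂ T n (σ ⟨$⟩ʳ L) j
  TPT-entry i j = begin
    (T n · P σ · T n) i j                                ≡⟨ ·-assoc (T n) (P σ) (T n) i j ⟩
    (T n · (P σ · T n)) i j                              ≡⟨ T·-entry (P σ · T n) i j ⟩
    (P σ · T n) i j +₂ c i *₂ (P σ · T n) L j            ≡⟨ cong₂ (λ x y → x +₂ c i *₂ y) (P·-entry σ (T n) i j) (P·-entry σ (T n) L j) ⟩
    T n (σ ⟨$⟩ʳ i) j +₂ c i *₂ T n (σ ⟨$⟩ʳ L) j          ∎

  Q≈TPT : Q σ ≈M (T n · P σ · T n)
  Q≈TPT i j = trans (Q-entry i j) (sym (TPT-entry i j))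

mainTheorem4 : (n : ℕ) → 1 ≤ n →
    (T n · T n) ≈M idM
    × ((σ : Sym n) → (Q σ ≈M (T n · P σ · T n)) × IsInvertible (Q σ))
mainTheorem4 n _ = T-involutive n , λ σ → Q≈TPT σ , Q-invertible σ
  where
  Q-invertible : (σ : Sym n) → IsInvertible (Q σ)
  Q-invertible σ = IsInvertible-resp-≈M (Q≈TPT σ)
    (IsInvertible-conjugate {S = T n} {P σ} (T-involutive n) (P-invertible σ))
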